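{- Let $H=(V,E,C,\ell)$ be an edge-colored hypergraph with nonnegative edge weights $w$, and suppose that for each node $v$ the list of incident edges is given sorted by color. The algorithm \textsf{LocalRatioECC} described in the context outputs a set $D\subseteq E$ such that no two edges of $E\setminus D$ form a bad edge pair (so nodes can be colored so that every edge of $E\setminus D$ is satisfied), and $w(D)\le 2\,\mathrm{OPT}$, where $\mathrm{OPT}$ is the optimal value of \textsc{MinECC} on $H$; i.e., it is a 2-approximation algorithm for \textsc{MinECC}. Moreover it runs in $O(\sum_{v\in V} d_v)=O(\mu)$ time, where $d_v$ is the degree of $v$ and $\mu=\sum_{e\in E}|e|$.
   Context: An edge-colored hypergraph $H=(V,E,C,\ell)$ has node set $V$, hyperedge set $E$ (each $e\subseteq V$), color set $C=\{1,\dots,k\}$, and a map $\ell:E\to C$ giving each hyperedge a color; each edge has weight $w(e)\ge 0$, and $w(A)=\sum_{e\in A}w(e)$. In \textsc{MinECC} (minimum edge-colored clustering) one assigns each node a color; a hyperedge $e$ is satisfied if all its nodes receive color $\ell(e)$, otherwise unsatisfied; the goal is to minimize the total weight of unsatisfied edges. Equivalently, one deletes a minimum-weight set of edges so that no bad edge pair remains, where $(e,f)$ is a bad edge pair if $e\cap f\neq\emptyset$ and $\ell(e)\neq\ell(f)$. Let $E(v)$ be the set of edges containing $v$, $d_v=|E(v)|$. Algorithm \textsf{LocalRatioECC}: maintain current weights (initially $w(e)$) and a set $D=\emptyset$. For each $v\in V$ in turn: let $e_{v(1)},\dots,e_{v(d_v)}$ be the edges of $E(v)$ sorted by color in increasing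 order; set $f=1$, $b=d_v$; while $e_{v(b)}\in D$ and $b>f$, decrement $b$; while $e_{v(f)}\in D$ and $b>f$, increment $f$. Then, while $\ell(e_{v(f)})\neq\ell(e_{v(b)})$: if $w(e_{v(f)})<w(e_{v(b)})$, add $e_{v(f)}$ to $D$, set $w(e_{v(b)})\gets w(e_{v(b)})-w(e_{v(f)})$, and increment $f$ while $e_{v(f)}\in D$ and $b>f$; if $w(e_{v(f)})=w(e_{v(b)})$, add both $e_{v(f)},e_{v(b)}$ to $D$, increment $f$ while $e_{v(f)}\in D$ and $b>f$, then decrement $b$ while $e_{v(b)}\in D$ and $b>f$; otherwise add $e_{v(b)}$ to $D$, set $w(e_{v(f)})\gets w(e_{v(f)})-w(e_{v(b)})$, and decrement $b$ while $e_{v(b)}\in D$ and $b>f$. After processing all nodes, return $D$. (The approximation guarantee is with respect to the original weights.)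
   Formalization: The nonnegative edge weights w are rational. -}

module Defs where

open import Data.Bool using (Bool; true; false; if_then_else_; _∧_; not)
open import Data.Nat as ℕ using (ℕ; zero; suc; _∸_)
open import Data.Fin as Fin using (Fin; toℕ)
open import Data.List using (List; []; _∷_; length; foldl; foldr; map; allFin)
open import Data.List.Membership.Propositional using (_∈_)
open import Data.List.Relation.Unary.Unique.Propositional using (Unique)
open import Data.List.Relation.Unary.Linked using (Linked)
open import Data.Rational as ℚ using (ℚ; 0ℚ)
open import Data.Rational.Properties as ℚP using ()
open import Relation.Nullary using (yes; no)
open import Relation.Nullary.Decidable using (⌊_⌋)
open import Function.Bundles using (_⇔_)
open import Data.Product using (Σ; _×_; _,_; proj₁; proj₂)
open import Relation.Binary.PropositionalEquality using (_≡_; _≢_)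

-- V = Fin n, E = Fin m, C = Fin k (colors 1..k as 0..k-1),
--   edge e ⊆ V given as a list of nodes, ℓ = color, w = weight,
--   inc v = the list of edges incident to v (supposed sorted by color).

record ECHypergraph : Set where
  field
    n m k  : ℕ
    edge   : Fin m → List (Fin n)
    color  : Fin m → Fin k
    weight : Fin m → ℚ
    inc    : Fin n → List (Fin m)

module _ (H : ECHypergraph) where
  open ECHypergraph H

  NonNegWeights : Set
  NonNegWeights = ∀ e → 0ℚ ℚ.≤ weight e

  ValidIncidence : Set
  ValidIncidence = ∀ v →
      (∀ e → (e ∈ inc v) ⇔ (v ∈ edge e))
    × Unique (inc v)
    × Linked (λ e f → toℕ (color e) ℕ.≤ toℕ (color f)) (inc v)

  deg : Fin n → ℕ
  deg v = length (inc v)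

  sumDeg : ℕ
  sumDeg = foldr (λ v s → deg v ℕ.+ s) 0 (allFin n)

  -- w(A) for A ⊆ E given by its indicator, w.r.t. the ORIGINAL weights
  wOf : (Fin m → Bool) → ℚ
  wOf A = foldr (λ e s → (if A e then weight e else 0ℚ) ℚ.+ s) 0ℚ (allFin m)

  BadPair : Fin m → Fin m → Set
  BadPair e f = Σ (Fin n) (λ v → (v ∈ edge e) × (v ∈ edge f)) × (color e ≢ color f)

  satisfiedᵇ : (Fin n → Fin k) → Fin m → Bool
  satisfiedᵇ c e = foldr (λ v r → ⌊ c v Fin.≟ color e ⌋ ∧ r) true (edge e)

  cost : (Fin n → Fin k) → ℚ
  cost c = wOf (λ e → not (satisfiedᵇ c e))

  -- Algorithm LocalRatioECC.
  -- State: indicator of D, current weights, and a step counter counting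
  -- every iteration of every while-loop body (for the running time).

  record St : Set where
    constructor st
    field
      inD   : Fin m → Bool
      wt    : Fin m → ℚ
      steps : ℕ

  addD : Fin m → (Fin m → Bool) → (Fin m → Bool)
  addD e D x = if ⌊ x Fin.≟ e ⌋ then true else D x

  setW : Fin m → ℚ → (Fin m → ℚ) → (Fin m → ℚ)
  setW e q w x = if ⌊ x Fin.≟ e ⌋ then q else w x

  at : Fin m → List (Fin m) → ℕ → Fin m
  at d []       _       = d
  at d (x ∷ xs) zero    = x
  at d (x ∷ xs) (suc i) = at d xs i

  -- "while e_f ∈ D and b > f, increment f"   (t = fuel, c = step counter)
  incF : ℕ → (Fin m → Bool) → (ℕ → Fin m) → ℕ → ℕ → ℕ → ℕ × ℕ
  incF zero    D e f b c = f , c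
  incF (suc t) D e f b c =
    if D (e f) ∧ ⌊ f ℕ.<? b ⌋ then incF t D e (suc f) b (suc c) else (f , c)

  -- "while e_b ∈ D and b > f, decrement b"
  decB : ℕ → (Fin m → Bool) → (ℕ → Fin m) → ℕ → ℕ → ℕ → ℕ × ℕ
  decB zero    D e f b c = b , c
  decB (suc t) D e f b c =
    if D (e b) ∧ ⌊ f ℕ.<? b ⌋ then decB t D e f (b ∸ 1) (suc c) else (b , c)

  -- main while loop "while ℓ(e_f) ≠ ℓ(e_b)"; t = fuel, d = fuel for the
  -- pointer loops
  mainLoop : ℕ → ℕ → (ℕ → Fin m) → St → ℕ → ℕ → St
  mainLoop zero    d e s f b = s
  mainLoop (suc t) d e (st D w c) f b with color (e f) Fin.≟ color (e b)
  ... | yes _ = st D w c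
  ... | no  _ with w (e f) ℚP.<? w (e b) | w (e f) ℚP.≟ w (e b)
  ... | yes _ | _ =
    let D′ = addD (e f) D
        w′ = setW (e b) (w (e b) ℚ.- w (e f)) w
        fc = incF d D′ e f b (suc c)
    in mainLoop t d e (st D′ w′ (proj₂ fc)) (proj₁ fc) b
  ... | no _ | yes _ =
    let D′ = addD (e b) (addD (e f) D)
        fc = incF d D′ e f b (suc c)
        bc = decB d D′ e (proj₁ fc) b (proj₂ fc)
    in mainLoop t d e (st D′ w (proj₂ bc)) (proj₁ fc) (proj₁ bc)
  ... | no _ | no _ =
    let D′ = addD (e b) D
        w′ = setW (e f) (w (e f) ℚ.- w (e b)) w
        bc = decB d D′ e f b (suc c)
    in mainLoop t d e (st D′ w′ (proj₂ bc)) f (proj₁ bc)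

  -- processing one node v, whose sorted incidence list is L
  -- (0-based indices: f = 0, b = d_v - 1)
  processNode : List (Fin m) → St → St
  processNode []          s          = s
  processNode L@(x ∷ _)   (st D w c) =
    let d  = length L
        e  = at x L
        bc = decB d D e 0 (d ∸ 1) c
        fc = incF d D e 0 (proj₁ bc) (proj₂ bc)
    in mainLoop (suc d) d e (st D w (proj₂ fc)) (proj₁ fc) (proj₁ bc)

  runECC : St
  runECC = foldl (λ s v → processNode (inc v) s) (st (λ _ → false) weight 0) (allFin n)

  outD : Fin m → Bool
  outD = St.inD runECC

  outSteps : ℕ
  outSteps = St.steps runECC

{-# OPTIONS --safe #-}
-- Local ratio.  Give every edge a residual weight, w(e) at the start and 0 once the edge is
-- deleted, and call w(e) minus the residual the amount paid on e.  An iteration of the loop at a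
-- node v pays the same amount δ, the smaller of the two residuals, on the edges e_f and e_b; they
-- meet in v and have different colors, so every set U of edges meeting all bad pairs (such as the
-- unsatisfied edges of a coloring) receives at least half of each payment.  Residuals stay in
-- [0, w(e)], deleted edges are fully paid, and so w(D) ≤ paid(E) ≤ 2 paid(U) ≤ 2 w(U).
-- When the loop at v stops, the surviving edges of E(v) lie between positions f and b, whose
-- colors agree; E(v) is sorted by color, so they all share it, and later nodes only delete more.
-- An iteration costs one step plus its pointer moves, and it moves a pointer at least once because
-- the edge it deletes is skipped; so steps + 2(b − f) never increases, and v costs at most 2 d_v.
module Submission where

open import Defs
open import Algebra.Bundles using (CommutativeMonoid)
open import Data.Bool using (Bool; true; false; if_then_else_; not; _∧_)
open import Data.Bool.Properties using (not-¬)
open import Data.Empty using (⊥-elim)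
open import Data.Fin using (Fin)
open import Data.Fin as Fin using (toℕ)
open import Data.Fin.Properties using (toℕ-injective)
open import Data.List using (List; []; _∷_; length; foldr; foldl; allFin; tabulate)
open import Data.List.Membership.Propositional using (_∈_)
open import Data.List.Membership.Propositional.Properties using (∈-allFin)
open import Data.List.Relation.Unary.All as All using ()
open import Data.List.Relation.Unary.AllPairs using (AllPairs; _∷_)
open import Data.List.Relation.Unary.Any using (here; there)
open import Data.List.Relation.Unary.Linked using (Linked)
open import Data.List.Relation.Unary.Linked.Properties using (Linked⇒AllPairs)
open import Data.Nat using (ℕ; zero; suc)
open import Data.Nat as ℕ using ()
import Data.Nat.Properties as ℕP
open import Data.Nat.Tactic.RingSolver using () renaming (solve to solve-ℕ)
open import Data.Product using (Σ; _×_; _,_; proj₁; proj₂; ∃-syntax)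
open import Data.Rational as ℚ using (1ℚ)
import Data.Rational.Properties as ℚP
open import Data.Sum using (_⊎_; inj₁; inj₂)
open import Data.Vec.Functional using (Vector)
open import Function using (_∘_; id)
open import Function.Bundles using (Equivalence)
open import Level using (0ℓ)
open import Relation.Binary.Core using (Rel)
open import Relation.Binary.Definitions using (Reflexive)
open import Relation.Binary.PropositionalEquality using (_≡_; _≢_; _≗_; refl; sym; trans; cong; cong₂; subst)
open import Relation.Nullary using (¬_; yes; no; contradiction)
open import Relation.Nullary.Decidable using (⌊_⌋; dec⇒maybe)
open import Tactic.RingSolver using (solve-∀)
open import Tactic.RingSolver.Core.AlmostCommutativeRing using (AlmostCommutativeRing; fromCommutativeRing)

open import Algebra.Properties.CommutativeMonoid.Sum ℚP.+-0-commutativeMonoid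
  using (sum; ∑-distrib-+; sum-cong-≗; sum-replicate-zero)
open import Algebra.Properties.CommutativeSemigroup
  (CommutativeMonoid.commutativeSemigroup ℚP.+-0-commutativeMonoid) using (interchange)

module Rational where
  open ℚ using (ℚ; 0ℚ; _+_; _-_; -_; _*_; _≤_)
  open ℚP.≤-Reasoning

  ring : AlmostCommutativeRing 0ℓ 0ℓ
  ring = fromCommutativeRing ℚP.+-*-commutativeRing (λ x → dec⇒maybe (0ℚ ℚP.≟ x))

  p-[q-r]≡p-q+r : ∀ p q r → p - (q - r) ≡ p - q + r
  p-[q-r]≡p-q+r = solve-∀ ring

  p+p≡[1+1]*p : ∀ p → p + p ≡ (1ℚ + 1ℚ) * p
  p+p≡[1+1]*p = solve-∀ ring

  p≤q⇒0≤q-p : ∀ {p q} → p ≤ q → 0ℚ ≤ q - p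
  p≤q⇒0≤q-p {p} {q} p≤q = subst (_≤ q - p) (ℚP.+-inverseʳ p) (ℚP.+-monoˡ-≤ (- p) p≤q)

  0≤q⇒p-q≤p : ∀ {p q} → 0ℚ ≤ q → p - q ≤ p
  0≤q⇒p-q≤p {p} 0≤q =
    subst (p - _ ≤_) (ℚP.+-identityʳ p) (ℚP.+-monoʳ-≤ p (ℚP.neg-antimono-≤ 0≤q))

  p≤[u]p+[v]p : ∀ {p} u v → 0ℚ ≤ p → u ≡ true ⊎ v ≡ true →
                p ≤ (if u then p else 0ℚ) + (if v then p else 0ℚ)
  p≤[u]p+[v]p {p} true  true  0≤p _ = begin
    p      ≡⟨ ℚP.+-identityʳ p ⟨
    p + 0ℚ ≤⟨ ℚP.+-monoʳ-≤ p 0≤p ⟩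
    p + p  ∎
  p≤[u]p+[v]p {p} true  false _ _ = ℚP.≤-reflexive (sym (ℚP.+-identityʳ p))
  p≤[u]p+[v]p {p} false true  _ _ = ℚP.≤-reflexive (sym (ℚP.+-identityˡ p))
  p≤[u]p+[v]p     false false _ (inj₁ ())
  p≤[u]p+[v]p     false false _ (inj₂ ())

  sum-mono-≤ : ∀ {n} {f g : Vector ℚ n} → (∀ i → f i ≤ g i) → sum f ≤ sum g
  sum-mono-≤ {zero}  f≤g = ℚP.≤-refl
  sum-mono-≤ {suc n} f≤g = ℚP.+-mono-≤ (f≤g Fin.zero) (sum-mono-≤ (f≤g ∘ Fin.suc))

  sum-zero : ∀ {n} {f : Vector ℚ n} → (∀ i → f i ≡ 0ℚ) → sum f ≡ 0ℚ
  sum-zero {n} f≡0 = trans (sum-cong-≗ f≡0) (sum-replicate-zero n)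

  foldr-+-tabulate : ∀ {n} {A : Set} (g : A → ℚ) (h : Fin n → A) →
                     foldr (λ x s → g x + s) 0ℚ (tabulate h) ≡ sum (g ∘ h)
  foldr-+-tabulate {zero}  g h = refl
  foldr-+-tabulate {suc n} g h = cong (g (h Fin.zero) +_) (foldr-+-tabulate g (h ∘ Fin.suc))

  point : ∀ {n} → Fin n → ℚ → Vector ℚ n
  point a x i = if ⌊ i Fin.≟ a ⌋ then x else 0ℚ

  point-suc : ∀ {n} (a : Fin n) x i → point (Fin.suc a) x (Fin.suc i) ≡ point a x i
  point-suc a x i with i Fin.≟ a
  ... | yes _ = refl
  ... | no _  = refl

  sum-point : ∀ {n} (a : Fin n) x → sum (point a x) ≡ x
  sum-point {suc n} Fin.zero x =
    trans (cong (x +_) (sum-zero {n} (λ _ → refl))) (ℚP.+-identityʳ x)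
  sum-point (Fin.suc a) x = begin-equality
    0ℚ + sum (point (Fin.suc a) x ∘ Fin.suc) ≡⟨ ℚP.+-identityˡ _ ⟩
    sum (point (Fin.suc a) x ∘ Fin.suc)      ≡⟨ sum-cong-≗ (point-suc a x) ⟩
    sum (point a x)                          ≡⟨ sum-point a x ⟩
    x                                        ∎

  mask : ∀ {n} → Vector Bool n → Vector ℚ n → Vector ℚ n
  mask U p i = if U i then p i else 0ℚ

  mask-cong : ∀ {n} U {p q : Vector ℚ n} → p ≗ q → mask U p ≗ mask U q
  mask-cong U p≗q i = cong (if U i then_else 0ℚ) (p≗q i)

  mask-mono-≤ : ∀ {n} U {p q : Vector ℚ n} → (∀ i → p i ≤ q i) → ∀ i → mask U p i ≤ mask U q i
  mask-mono-≤ U p≤q i with U i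
  ... | true  = p≤q i
  ... | false = ℚP.≤-refl

  mask-zero : ∀ {n} U {p : Vector ℚ n} → (∀ i → p i ≡ 0ℚ) → ∀ i → mask U p i ≡ 0ℚ
  mask-zero U p≡0 i with U i
  ... | true  = p≡0 i
  ... | false = refl

  mask-+ : ∀ {n} U (p q : Vector ℚ n) i → mask U (λ j → p j + q j) i ≡ mask U p i + mask U q i
  mask-+ U p q i with U i
  ... | true  = refl
  ... | false = sym (ℚP.+-identityˡ 0ℚ)

  mask-point : ∀ {n} U (a : Fin n) x i → mask U (point a x) i ≡ point a (if U a then x else 0ℚ) i
  mask-point U a x i with i Fin.≟ a
  ... | yes refl = refl
  ... | no _     = mask-zero U (λ _ → refl) i

  sum-mask-point : ∀ {n} U (a : Fin n) x → sum (mask U (point a x)) ≡ (if U a then x else 0ℚ)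
  sum-mask-point U a x = trans (sum-cong-≗ (mask-point U a x)) (sum-point a _)

module LocalRatio (H : ECHypergraph) where
  open ECHypergraph H
  open ℚ using (ℚ; 0ℚ; _+_; _-_; _*_; _≤_)
  open ℚP.≤-Reasoning
  open Rational

  residual : (Fin m → Bool) → (Fin m → ℚ) → Fin m → ℚ
  residual D w e = if D e then 0ℚ else w e

  paid : (Fin m → Bool) → (Fin m → ℚ) → Fin m → ℚ
  paid D w e = weight e - residual D w e

  residual-deleted : ∀ D w {e} → D e ≡ true → residual D w e ≡ 0ℚ
  residual-deleted D w De rewrite De = refl

  residual-live : ∀ D w {e} → D e ≡ false → residual D w e ≡ w e
  residual-live D w De rewrite De = refl

  residual-frame : ∀ D w D′ w′ {e} → D′ e ≡ D e → w′ e ≡ w e →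
                   residual D′ w′ e ≡ residual D w e
  residual-frame D w D′ w′ D′e≡De w′e≡we rewrite D′e≡De | w′e≡we = refl

  ResidualBounded : (Fin m → Bool) → (Fin m → ℚ) → Set
  ResidualBounded D w = ∀ e → 0ℚ ≤ residual D w e × residual D w e ≤ weight e

  live-bounds : ∀ {D w e} → ResidualBounded D w → D e ≡ false → 0ℚ ≤ w e × w e ≤ weight e
  live-bounds {D} {w} {e} bounded De =
    subst (λ r → 0ℚ ≤ r × r ≤ weight e) (residual-live D w De) (bounded e)

  CoversBadPairs : (Fin m → Bool) → Set
  CoversBadPairs U = ∀ {a b} → BadPair H a b → U a ≡ true ⊎ U b ≡ true

  HalfOnEveryCover : (Fin m → ℚ) → Set
  HalfOnEveryCover p = ∀ {U} → CoversBadPairs U → sum p ≤ sum (mask U p) + sum (mask U p)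

  halfOnEveryCover-cong : ∀ {p q} → p ≗ q → HalfOnEveryCover p → HalfOnEveryCover q
  halfOnEveryCover-cong {p} {q} p≗q half {U} covers = begin
    sum q                              ≡⟨ sum-cong-≗ p≗q ⟨
    sum p                              ≤⟨ half covers ⟩
    sum (mask U p) + sum (mask U p)    ≡⟨ cong (λ s → s + s) (sum-cong-≗ (mask-cong U p≗q)) ⟩
    sum (mask U q) + sum (mask U q)    ∎

  charge : Fin m → Fin m → ℚ → Fin m → ℚ
  charge a b δ e = point a δ e + point b δ e

  -- A cover contains a or b, so it receives at least δ of the 2δ charged.
  halfOnEveryCover-charge : ∀ {p a b δ} → BadPair H a b → 0ℚ ≤ δ → HalfOnEveryCover p →
                            HalfOnEveryCover (λ e → p e + charge a b δ e)
  halfOnEveryCover-charge {p} {a} {b} {δ} bad 0≤δ half {U} covers = begin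
    sum (λ e → p e + charge a b δ e)      ≡⟨ ∑-distrib-+ p (charge a b δ) ⟩
    sum p + sum (charge a b δ)            ≡⟨ cong (sum p +_) sum-charge ⟩
    sum p + (δ + δ)                       ≤⟨ ℚP.+-mono-≤ (half covers) (ℚP.+-mono-≤ δ≤μ δ≤μ) ⟩
    (M + M) + (μ + μ)                     ≡⟨ interchange M M μ μ ⟩
    (M + μ) + (M + μ)                     ≡⟨ cong (λ s → s + s) masked-sum ⟨
    sum (mask U (λ e → p e + charge a b δ e)) + sum (mask U (λ e → p e + charge a b δ e)) ∎
    where
      M = sum (mask U p)
      μ = sum (mask U (charge a b δ))

      sum-charge : sum (charge a b δ) ≡ δ + δ
      sum-charge = trans (∑-distrib-+ (point a δ) (point b δ)) (cong₂ _+_ (sum-point a δ) (sum-point b δ))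

      masked-sum : sum (mask U (λ e → p e + charge a b δ e)) ≡ M + μ
      masked-sum = trans (sum-cong-≗ (mask-+ U p (charge a b δ)))
                         (∑-distrib-+ (mask U p) (mask U (charge a b δ)))

      δ≤μ : δ ≤ μ
      δ≤μ = begin
        δ
          ≤⟨ p≤[u]p+[v]p (U a) (U b) 0≤δ (covers bad) ⟩
        (if U a then δ else 0ℚ) + (if U b then δ else 0ℚ)
          ≡⟨ cong₂ _+_ (sum-mask-point U a δ) (sum-mask-point U b δ) ⟨
        sum (mask U (point a δ)) + sum (mask U (point b δ))
          ≡⟨ ∑-distrib-+ (mask U (point a δ)) (mask U (point b δ)) ⟨
        sum (λ e → mask U (point a δ) e + mask U (point b δ) e)
          ≡⟨ sum-cong-≗ (mask-+ U (point a δ) (point b δ)) ⟨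
        μ ∎

  record Invariant (D : Fin m → Bool) (w : Fin m → ℚ) : Set where
    field
      residual-bounded         : ResidualBounded D w
      paid-half-on-every-cover : HalfOnEveryCover (paid D w)

  open Invariant public

  live-weight-nonneg : ∀ {D w e} → Invariant D w → D e ≡ false → 0ℚ ≤ w e
  live-weight-nonneg {D} {w} inv De = proj₁ (live-bounds {D} {w} (residual-bounded inv) De)

  initial-invariant : NonNegWeights H → Invariant (λ _ → false) weight
  initial-invariant nonneg = record
    { residual-bounded         = λ e → nonneg e , ℚP.≤-refl
    ; paid-half-on-every-cover = λ {U} _ → ℚP.≤-reflexive (begin-equality
        sum (paid _ weight)                                         ≡⟨ sum-zero nothing-paid ⟩
        0ℚ                                                          ≡⟨ ℚP.+-identityʳ 0ℚ ⟨
        0ℚ + 0ℚ                                                     ≡⟨ cong (λ s → s + s) nothing-masked ⟨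
        sum (mask U (paid _ weight)) + sum (mask U (paid _ weight)) ∎) }
    where
      nothing-paid : ∀ e → paid (λ _ → false) weight e ≡ 0ℚ
      nothing-paid e = ℚP.+-inverseʳ (weight e)

      nothing-masked : ∀ {U} → sum (mask U (paid (λ _ → false) weight)) ≡ 0ℚ
      nothing-masked {U} = sum-zero (mask-zero U nothing-paid)

  record Payment (a b : Fin m) (δ : ℚ) (D : Fin m → Bool) (w : Fin m → ℚ)
                 (D′ : Fin m → Bool) (w′ : Fin m → ℚ) : Set where
    field
      distinct  : a ≢ b
      a-live    : D a ≡ false
      b-live    : D b ≡ false
      δ-nonneg  : 0ℚ ≤ δ
      δ≤w-a     : δ ≤ w a
      δ≤w-b     : δ ≤ w b
      at-a      : residual D′ w′ a ≡ w a - δ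
      at-b      : residual D′ w′ b ≡ w b - δ
      elsewhere : ∀ {e} → e ≢ a → e ≢ b → residual D′ w′ e ≡ residual D w e

  module _ {a b δ D w D′ w′} (pay : Payment a b δ D w D′ w′) where
    open Payment pay

    reduced-residual-bounded : ∀ {x} → ResidualBounded D w → D x ≡ false → δ ≤ w x →
                               residual D′ w′ x ≡ w x - δ →
                               0ℚ ≤ residual D′ w′ x × residual D′ w′ x ≤ weight x
    reduced-residual-bounded bounded Dx δ≤wx reduced rewrite reduced =
      p≤q⇒0≤q-p δ≤wx , ℚP.≤-trans (0≤q⇒p-q≤p δ-nonneg) (proj₂ (live-bounds {D} {w} bounded Dx))

    payment-preserves-bounded : ResidualBounded D w → ResidualBounded D′ w′
    payment-preserves-bounded bounded e with e Fin.≟ a | e Fin.≟ b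
    ... | yes refl | _        = reduced-residual-bounded bounded a-live δ≤w-a at-a
    ... | no _     | yes refl = reduced-residual-bounded bounded b-live δ≤w-b at-b
    ... | no e≢a   | no e≢b rewrite elsewhere e≢a e≢b = bounded e

    paid-after-payment : paid D′ w′ ≗ λ e → paid D w e + charge a b δ e
    paid-after-payment e with e Fin.≟ a | e Fin.≟ b
    ... | yes refl | yes refl = contradiction refl distinct
    ... | yes refl | no _ rewrite at-a | a-live | ℚP.+-identityʳ δ = p-[q-r]≡p-q+r (weight a) (w a) δ
    ... | no _ | yes refl rewrite at-b | b-live | ℚP.+-identityˡ δ = p-[q-r]≡p-q+r (weight b) (w b) δ
    ... | no e≢a | no e≢b rewrite elsewhere e≢a e≢b = sym (ℚP.+-identityʳ (paid D w e))

    payment-preserves-invariant : BadPair H a b → Invariant D w → Invariant D′ w′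
    payment-preserves-invariant bad inv = record
      { residual-bounded         = payment-preserves-bounded (residual-bounded inv)
      ; paid-half-on-every-cover = halfOnEveryCover-cong (sym ∘ paid-after-payment)
          (halfOnEveryCover-charge bad δ-nonneg (paid-half-on-every-cover inv)) }

  all-colored : ∀ (col : Fin n → Fin k) c vs → foldr (λ v r → ⌊ col v Fin.≟ c ⌋ ∧ r) true vs ≡ true →
                ∀ {v} → v ∈ vs → col v ≡ c
  all-colored col c (u ∷ vs) all≡true v∈ with col u Fin.≟ c | v∈
  ... | yes colu≡c | here refl = colu≡c
  ... | yes _      | there v∈vs = all-colored col c vs all≡true v∈vs
  all-colored col c (u ∷ vs) () v∈ | no _ | _

  unsatisfied-covers : ∀ col → CoversBadPairs (λ e → not (satisfiedᵇ H col e))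
  unsatisfied-covers col {a} {b} ((v , v∈a , v∈b) , colors-differ)
    with satisfiedᵇ H col a in sat-a | satisfiedᵇ H col b in sat-b
  ... | false | _     = inj₁ refl
  ... | true  | false = inj₂ refl
  ... | true  | true  = contradiction
    (trans (sym (all-colored col (color a) (edge a) sat-a v∈a)) (all-colored col (color b) (edge b) sat-b v∈b))
    colors-differ

  wOf≡sum : ∀ A → wOf H A ≡ sum (mask A weight)
  wOf≡sum A = foldr-+-tabulate (mask A weight) id

  invariant⇒wOf≤2*cost : ∀ {D w} → Invariant D w → ∀ col → wOf H D ≤ (1ℚ + 1ℚ) * cost H col
  invariant⇒wOf≤2*cost {D} {w} inv col = begin
    wOf H D                    ≡⟨ wOf≡sum D ⟩
    sum (mask D weight)        ≤⟨ sum-mono-≤ deleted≤paid ⟩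
    sum (paid D w)             ≤⟨ paid-half-on-every-cover inv (unsatisfied-covers col) ⟩
    M + M                      ≤⟨ ℚP.+-mono-≤ M≤cost M≤cost ⟩
    cost H col + cost H col    ≡⟨ p+p≡[1+1]*p (cost H col) ⟩
    (1ℚ + 1ℚ) * cost H col     ∎
    where
      U = λ e → not (satisfiedᵇ H col e)
      M = sum (mask U (paid D w))

      deleted≤paid : ∀ e → mask D weight e ≤ paid D w e
      deleted≤paid e with D e | residual-bounded inv e
      ... | true  | _         = ℚP.≤-reflexive (sym (ℚP.+-identityʳ (weight e)))
      ... | false | (_ , r≤w) = p≤q⇒0≤q-p r≤w

      paid≤weight : ∀ e → paid D w e ≤ weight e
      paid≤weight e = 0≤q⇒p-q≤p (proj₁ (residual-bounded inv e))

      M≤cost : M ≤ cost H col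
      M≤cost = begin
        M                    ≤⟨ sum-mono-≤ (mask-mono-≤ U paid≤weight) ⟩
        sum (mask U weight)  ≡⟨ wOf≡sum U ⟨
        cost H col           ∎

module StepCount where
  open import Data.Nat using (_+_; _*_; _≤_)
  open ℕP using (+-cancelʳ-≤; +-monoˡ-≤; +-monoʳ-≤; m≤m+n)
  open ℕP.≤-Reasoning

  potential-step : ∀ {s c c₁ c₂ f f′ b b′} → s + 2 * f′ ≤ c₂ + 2 * b′ →
                   c₁ + f ≡ suc c + f′ → c₂ + b′ ≡ c₁ + b → suc (f + b′) ≤ f′ + b →
                   s + 2 * f ≤ c + 2 * b
  potential-step {s} {c} {c₁} {c₂} {f} {f′} {b} {b′} rest count-f count-b progress =
    +-cancelʳ-≤ (2 * f′) _ _ (begin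
      s + 2 * f + 2 * f′           ≡⟨ solve-ℕ (s ∷ f ∷ f′ ∷ []) ⟩
      s + 2 * f′ + 2 * f           ≤⟨ +-monoˡ-≤ (2 * f) rest ⟩
      c₂ + 2 * b′ + 2 * f          ≡⟨ solve-ℕ (c₂ ∷ b′ ∷ f ∷ []) ⟩
      c₂ + b′ + (b′ + 2 * f)       ≡⟨ cong (_+ (b′ + 2 * f)) count-b ⟩
      c₁ + b + (b′ + 2 * f)        ≡⟨ solve-ℕ (c₁ ∷ b ∷ b′ ∷ f ∷ []) ⟩
      c₁ + f + (b + b′ + f)        ≡⟨ cong (_+ (b + b′ + f)) count-f ⟩
      suc c + f′ + (b + b′ + f)    ≡⟨ solve-ℕ (c ∷ f ∷ f′ ∷ b ∷ b′ ∷ []) ⟩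
      c + b + f′ + suc (f + b′)    ≤⟨ +-monoʳ-≤ (c + b + f′) progress ⟩
      c + b + f′ + (f′ + b)        ≡⟨ solve-ℕ (c ∷ f′ ∷ b ∷ []) ⟩
      c + 2 * b + 2 * f′           ∎)

  potential-initial : ∀ {s c c₁ c₂ f₀ b₀ l} → s + 2 * f₀ ≤ c₂ + 2 * b₀ →
                      c₂ + 0 ≡ c₁ + f₀ → c₁ + b₀ ≡ c + l → b₀ ≤ l → s ≤ c + 2 * suc l
  potential-initial {s} {c} {c₁} {c₂} {f₀} {b₀} {l} rest count-f count-b b₀≤l =
    +-cancelʳ-≤ f₀ _ _ (begin
      s + f₀                 ≤⟨ +-monoʳ-≤ s (m≤m+n f₀ (f₀ + 0)) ⟩
      s + 2 * f₀             ≤⟨ rest ⟩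
      c₂ + 2 * b₀            ≡⟨ solve-ℕ (c₂ ∷ b₀ ∷ []) ⟩
      c₂ + 0 + b₀ + b₀       ≡⟨ cong (λ x → x + b₀ + b₀) count-f ⟩
      c₁ + f₀ + b₀ + b₀      ≡⟨ solve-ℕ (c₁ ∷ f₀ ∷ b₀ ∷ []) ⟩
      c₁ + b₀ + b₀ + f₀      ≡⟨ cong (λ x → x + b₀ + f₀) count-b ⟩
      c + l + b₀ + f₀        ≤⟨ +-monoˡ-≤ f₀ (+-monoʳ-≤ (c + l) b₀≤l) ⟩
      c + l + l + f₀         ≤⟨ +-monoˡ-≤ f₀ (m≤m+n (c + l + l) 2) ⟩
      c + l + l + 2 + f₀     ≡⟨ solve-ℕ (c ∷ l ∷ f₀ ∷ []) ⟩
      c + 2 * suc l + f₀     ∎)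

  fuel-step : ∀ {t f f′ b b′} → suc b ≤ f + suc t → suc (f + b′) ≤ f′ + b → suc b′ ≤ f′ + t
  fuel-step {t} {f} {f′} {b} {b′} fuel progress = +-cancelʳ-≤ f _ _ (begin
    suc b′ + f      ≡⟨ cong suc (ℕP.+-comm b′ f) ⟩
    suc (f + b′)    ≤⟨ progress ⟩
    f′ + b          ≤⟨ +-monoʳ-≤ f′ (ℕP.≤-pred (subst (suc b ≤_) (ℕP.+-suc f t) fuel)) ⟩
    f′ + (f + t)    ≡⟨ solve-ℕ (f′ ∷ f ∷ t ∷ []) ⟩
    f′ + t + f      ∎)

module Execution (H : ECHypergraph) where
  open ECHypergraph H
  open import Data.Nat using (_+_; _*_; _≤_; _<_; z≤n; s≤s)
  open ℕP using (≤-refl; ≤-trans; <⇒≤; ≤∧≢⇒<; ≮⇒≥; <⇒≱; ≤-<-trans; <-≤-trans; m≤n+m; n≤1+n;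
                 +-monoˡ-≤; +-monoʳ-≤; +-mono-≤)
  open LocalRatio H
  open StepCount

  _⊆_ : (Fin m → Bool) → (Fin m → Bool) → Set
  D ⊆ D′ = ∀ {e} → D e ≡ true → D′ e ≡ true

  ⊆-live : ∀ {D D′ e} → D ⊆ D′ → D′ e ≡ false → D e ≡ false
  ⊆-live {D} {e = e} D⊆D′ D′e with D e in De
  ... | true  = contradiction (D⊆D′ De) (not-¬ D′e)
  ... | false = refl

  addD-self : ∀ a D → addD H a D a ≡ true
  addD-self a D with a Fin.≟ a
  ... | yes _  = refl
  ... | no a≢a = contradiction refl a≢a

  addD-other : ∀ {a} D {e} → e ≢ a → addD H a D e ≡ D e
  addD-other {a} D {e} e≢a with e Fin.≟ a
  ... | yes e≡a = contradiction e≡a e≢a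
  ... | no _    = refl

  ⊆-addD : ∀ a D → D ⊆ addD H a D
  ⊆-addD a D {e} De with e Fin.≟ a
  ... | yes _ = refl
  ... | no _  = De

  setW-self : ∀ a q w → setW H a q w a ≡ q
  setW-self a q w with a Fin.≟ a
  ... | yes _  = refl
  ... | no a≢a = contradiction refl a≢a

  setW-other : ∀ {a} q w {e} → e ≢ a → setW H a q w e ≡ w e
  setW-other {a} q w {e} e≢a with e Fin.≟ a
  ... | yes e≡a = contradiction e≡a e≢a
  ... | no _    = refl

  at-∈ : ∀ {x} L {i} → i < length L → at H x L i ∈ L
  at-∈ (y ∷ ys) {zero}  _         = here refl
  at-∈ (y ∷ ys) {suc i} (s≤s i<) = there (at-∈ ys i<)

  ∈⇒at : ∀ x {L y} → y ∈ L → ∃[ i ] i < length L × at H x L i ≡ y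
  ∈⇒at x (here refl) = zero , s≤s z≤n , refl
  ∈⇒at x (there y∈)  with ∈⇒at x y∈
  ... | i , i< , at≡y = suc i , s≤s i< , at≡y

  at-monotone : ∀ {ℓ} {R : Rel (Fin m) ℓ} → Reflexive R → ∀ {x L} → AllPairs R L →
                ∀ {i j} → i ≤ j → j < length L → R (at H x L i) (at H x L j)
  at-monotone R-refl {L = _ ∷ _}  _            {zero}  {zero}  _         _        = R-refl
  at-monotone R-refl {L = _ ∷ ys} (y≤ys ∷ _)   {zero}  {suc j} _         (s≤s j<) =
    All.lookup y≤ys (at-∈ ys j<)
  at-monotone R-refl              (_ ∷ sorted) {suc i} {suc j} (s≤s i≤j) (s≤s j<) =
    at-monotone R-refl sorted i≤j j<

  module Pointers (d : ℕ) (e : ℕ → Fin m) where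

    DeletedBelow : (Fin m → Bool) → ℕ → Set
    DeletedBelow D f = ∀ {i} → i < f → D (e i) ≡ true

    DeletedAbove : (Fin m → Bool) → ℕ → Set
    DeletedAbove D b = ∀ {i} → b < i → i < d → D (e i) ≡ true

    deletedBelow-suc : ∀ {D f} → DeletedBelow D f → D (e f) ≡ true → DeletedBelow D (suc f)
    deletedBelow-suc below Df i<1+f with ℕP.m<1+n⇒m<n∨m≡n i<1+f
    ... | inj₁ i<f  = below i<f
    ... | inj₂ refl = Df

    deletedAbove-pred : ∀ {D b} → DeletedAbove D (suc b) → D (e (suc b)) ≡ true → DeletedAbove D b
    deletedAbove-pred above Db b<i i<d with ℕP.m≤n⇒m<n∨m≡n b<i
    ... | inj₁ 1+b<i = above 1+b<i i<d
    ... | inj₂ refl  = Db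

    deletedBelow-mono : ∀ {D D′ f} → D ⊆ D′ → DeletedBelow D f → DeletedBelow D′ f
    deletedBelow-mono D⊆D′ below i<f = D⊆D′ (below i<f)

    deletedAbove-mono : ∀ {D D′ b} → D ⊆ D′ → DeletedAbove D b → DeletedAbove D′ b
    deletedAbove-mono D⊆D′ above b<i i<d = D⊆D′ (above b<i i<d)

    record IncFPost (D : Fin m → Bool) (b f c f′ c′ : ℕ) : Set where
      field
        f≤f′          : f ≤ f′
        f′≤b          : f′ ≤ b
        deleted-below : DeletedBelow D f′
        live          : f′ < b → D (e f′) ≡ false
        count         : c′ + f ≡ c + f′

      moved : D (e f) ≡ true → f < b → f < f′
      moved Df f<b = ≤∧≢⇒< f≤f′ λ { refl → contradiction Df (not-¬ (live f<b)) }

    incF-stay : ∀ {D b f c} → f ≤ b → DeletedBelow D f → (f < b → D (e f) ≡ false) →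
                IncFPost D b f c f c
    incF-stay f≤b below live = record
      { f≤f′ = ≤-refl ; f′≤b = f≤b ; deleted-below = below ; live = live ; count = refl }

    incF-post : ∀ t {D f b c} → f ≤ b → b ≤ f + t → DeletedBelow D f →
                IncFPost D b f c (proj₁ (incF H t D e f b c)) (proj₂ (incF H t D e f b c))
    incF-post zero {f = f} {b} f≤b b≤f+0 below =
      incF-stay f≤b below λ f<b → contradiction (subst (b ≤_) (ℕP.+-identityʳ f) b≤f+0) (<⇒≱ f<b)
    incF-post (suc t) {D} {f} {b} {c} f≤b b≤f+1+t below with D (e f) in Df | f ℕ.<? b
    ... | true  | yes f<b = record
      { f≤f′ = ≤-trans (n≤1+n f) f≤f′ ; f′≤b = f′≤b ; deleted-below = deleted-below ; live = live
      ; count = ℕP.suc-injective (trans (sym (ℕP.+-suc _ f)) count) }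
      where open IncFPost (incF-post t {D} f<b (subst (b ≤_) (ℕP.+-suc f t) b≤f+1+t)
                                               (deletedBelow-suc {D} below Df))
    ... | true  | no f≮b = incF-stay f≤b below λ f<b → contradiction f<b f≮b
    ... | false | _      = incF-stay f≤b below λ _ → Df

    record DecBPost (D : Fin m → Bool) (f b c b′ c′ : ℕ) : Set where
      field
        f≤b′          : f ≤ b′
        b′≤b          : b′ ≤ b
        deleted-above : DeletedAbove D b′
        live          : f < b′ → D (e b′) ≡ false
        count         : c′ + b′ ≡ c + b

      moved : D (e b) ≡ true → f < b → b′ < b
      moved Db f<b = ≤∧≢⇒< b′≤b λ { refl → contradiction Db (not-¬ (live f<b)) }

    decB-stay : ∀ {D f b c} → f ≤ b → DeletedAbove D b → (f < b → D (e b) ≡ false) →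
                DecBPost D f b c b c
    decB-stay f≤b above live = record
      { f≤b′ = f≤b ; b′≤b = ≤-refl ; deleted-above = above ; live = live ; count = refl }

    decB-post : ∀ t {D f b c} → f ≤ b → b ≤ f + t → DeletedAbove D b →
                DecBPost D f b c (proj₁ (decB H t D e f b c)) (proj₂ (decB H t D e f b c))
    decB-post zero {f = f} {b} f≤b b≤f+0 above =
      decB-stay f≤b above λ f<b → contradiction (subst (b ≤_) (ℕP.+-identityʳ f) b≤f+0) (<⇒≱ f<b)
    decB-post (suc t) {D} {b = zero} f≤b _ above with D (e zero)
    ... | true  = decB-stay f≤b above λ ()
    ... | false = decB-stay f≤b above λ ()
    decB-post (suc t) {D} {f} {suc b} {c} f≤b b≤f+1+t above with D (e (suc b)) in Db | f ℕ.<? suc b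
    ... | true  | yes f<1+b = record
      { f≤b′ = f≤b′ ; b′≤b = ℕP.m≤n⇒m≤1+n b′≤b ; deleted-above = deleted-above ; live = live
      ; count = trans count (sym (ℕP.+-suc c b)) }
      where open DecBPost (decB-post t {D} (ℕP.≤-pred f<1+b)
                                         (ℕP.≤-pred (subst (suc b ≤_) (ℕP.+-suc f t) b≤f+1+t))
                                        (deletedAbove-pred {D} above Db))
    ... | true  | no f≮1+b = decB-stay f≤b above λ f<1+b → contradiction f<1+b f≮1+b
    ... | false | _        = decB-stay f≤b above λ _ → Db

  module MainLoop (v : Fin n) (d : ℕ) (e : ℕ → Fin m)
                  (incident : ∀ {i} → i < d → v ∈ edge (e i))
                  (sorted : ∀ {i j} → i ≤ j → j < d → toℕ (color (e i)) ≤ toℕ (color (e j))) where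
    open Pointers d e

    record Window (D : Fin m → Bool) (f b : ℕ) : Set where
      field
        f≤b           : f ≤ b
        b<d           : b < d
        deleted-below : DeletedBelow D f
        deleted-above : DeletedAbove D b
        ends-live     : f < b → D (e f) ≡ false × D (e b) ≡ false

      b≤f+d : b ≤ f + d
      b≤f+d = ≤-trans (<⇒≤ b<d) (m≤n+m d f)

    Monochromatic : (Fin m → Bool) → Set
    Monochromatic D = ∀ {i j} → i < d → j < d → D (e i) ≡ false → D (e j) ≡ false →
                      color (e i) ≡ color (e j)

    window-monochromatic : ∀ {D f b} → Window D f b → color (e f) ≡ color (e b) → Monochromatic D
    window-monochromatic {D} {f} {b} win same i<d j<d Di Dj = trans (pinned i<d Di) (sym (pinned j<d Dj))
      where
        open Window win
        pinned : ∀ {i} → i < d → D (e i) ≡ false → color (e i) ≡ color (e f)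
        pinned {i} i<d Di = toℕ-injective (ℕP.≤-antisym
          (subst (λ c → toℕ (color (e i)) ≤ toℕ c) (sym same) (sorted i≤b b<d))
          (sorted f≤i i<d))
          where
            f≤i : f ≤ i
            f≤i = ≮⇒≥ λ i<f → contradiction (deleted-below i<f) (not-¬ Di)
            i≤b : i ≤ b
            i≤b = ≮⇒≥ λ b<i → contradiction (deleted-above b<i i<d) (not-¬ Di)

    record Conflict (D : Fin m → Bool) (f b : ℕ) : Set where
      field
        f<b        : f < b
        front-live : D (e f) ≡ false
        back-live  : D (e b) ≡ false
        bad        : BadPair H (e f) (e b)

      front≢back : e f ≢ e b
      front≢back ef≡eb = proj₂ bad (cong color ef≡eb)

    conflict : ∀ {D f b} → Window D f b → color (e f) ≢ color (e b) → Conflict D f b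
    conflict win differ = record
      { f<b        = f<b
      ; front-live = proj₁ (ends-live f<b)
      ; back-live  = proj₂ (ends-live f<b)
      ; bad        = (v , incident (<-≤-trans f<b (<⇒≤ b<d)) , incident b<d) , differ }
      where
        open Window win
        f<b = ≤∧≢⇒< f≤b λ f≡b → differ (cong (color ∘ e) f≡b)

    record Outcome (D : Fin m → Bool) (c f b : ℕ) (s : St H) : Set where
      field
        extends       : D ⊆ St.inD s
        invariant     : Invariant (St.inD s) (St.wt s)
        monochromatic : Monochromatic (St.inD s)
        steps-bound   : St.steps s + 2 * f ≤ c + 2 * b

    -- The fuel t of mainLoop exceeds the width b − f of the window, which every iteration shrinks.
    LoopCorrect : ℕ → Set
    LoopCorrect t = ∀ {D w c f b} → Window D f b → suc b ≤ f + t → Invariant D w →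
                    Outcome D c f b (mainLoop H t d e (st D w c) f b)

    finished : ∀ {D w c f b} → Window D f b → Invariant D w → color (e f) ≡ color (e b) →
               Outcome D c f b (st D w c)
    finished {c = c} win inv same = record
      { extends       = id
      ; invariant     = inv
      ; monochromatic = window-monochromatic win same
      ; steps-bound   = +-monoʳ-≤ c (ℕP.*-monoʳ-≤ 2 (Window.f≤b win)) }

    record Iteration (D : Fin m → Bool) (c f b : ℕ) (s′ : St H) (f′ b′ : ℕ) : Set where
      field
        extends   : D ⊆ St.inD s′
        window    : Window (St.inD s′) f′ b′
        invariant : Invariant (St.inD s′) (St.wt s′)
        progress  : suc (f + b′) ≤ f′ + b
        steps-after-incF : ℕ
        count-f   : steps-after-incF + f ≡ suc c + f′
        count-b   : St.steps s′ + b′ ≡ steps-after-incF + b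

    iterate : ∀ {t D c f b s′ f′ b′} → Iteration D c f b s′ f′ b′ → suc b ≤ f + suc t →
              LoopCorrect t → Outcome D c f b (mainLoop H t d e s′ f′ b′)
    iterate {t} {c = c} {f} {b} {s′} {f′} {b′} it fuel loop = record
      { extends       = O.extends ∘ I.extends
      ; invariant     = O.invariant
      ; monochromatic = O.monochromatic
      ; steps-bound   = potential-step {St.steps (mainLoop H t d e s′ f′ b′)} {c} {I.steps-after-incF}
                          {St.steps s′} {f} {f′} {b} {b′} O.steps-bound I.count-f I.count-b I.progress }
      where
        module I = Iteration it
        module O = Outcome (loop I.window (fuel-step fuel I.progress) I.invariant)

    delete-front : ∀ {D w c f b} → Window D f b → Invariant D w →
                   color (e f) ≢ color (e b) → w (e f) ℚ.< w (e b) →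
                   let D′ = addD H (e f) D
                       fc = incF H d D′ e f b (suc c)
                   in  Iteration D c f b (st D′ (setW H (e b) (w (e b) ℚ.- w (e f)) w) (proj₂ fc))
                                 (proj₁ fc) b
    delete-front {D} {w} {c} {f} {b} win inv differ wf<wb = record
      { extends   = D⊆D′
      ; window    = record
          { f≤b           = I.f′≤b
          ; b<d           = W.b<d
          ; deleted-below = I.deleted-below
          ; deleted-above = deletedAbove-mono {D} D⊆D′ W.deleted-above
          ; ends-live     = λ f′<b → I.live f′<b , back-live′ }
      ; invariant = payment-preserves-invariant payment bad inv
      ; progress  = +-monoˡ-≤ b (I.moved (addD-self (e f) D) f<b)
      ; count-f   = I.count
      ; count-b   = refl }
      where
        open Conflict (conflict win differ)
        module W = Window win
        D′ = addD H (e f) D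
        w′ = setW H (e b) (w (e b) ℚ.- w (e f)) w

        D⊆D′ : D ⊆ D′
        D⊆D′ = ⊆-addD (e f) D

        module I = IncFPost (incF-post d {D′} {f} {b} {suc c} W.f≤b W.b≤f+d
                                       (deletedBelow-mono {D} D⊆D′ W.deleted-below))

        back-live′ : D′ (e b) ≡ false
        back-live′ = trans (addD-other D (front≢back ∘ sym)) back-live

        payment : Payment (e f) (e b) (w (e f)) D w D′ w′
        payment = record
          { distinct  = front≢back
          ; a-live    = front-live
          ; b-live    = back-live
          ; δ-nonneg  = live-weight-nonneg inv front-live
          ; δ≤w-a     = ℚP.≤-refl
          ; δ≤w-b     = ℚP.<⇒≤ wf<wb
          ; at-a      = trans (residual-deleted D′ w′ (addD-self (e f) D)) (sym (ℚP.+-inverseʳ (w (e f))))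
          ; at-b      = trans (residual-live D′ w′ back-live′) (setW-self (e b) _ w)
          ; elsewhere = λ ≢front ≢back →
              residual-frame D w D′ w′ (addD-other D ≢front) (setW-other _ w ≢back) }

    delete-both : ∀ {D w c f b} → Window D f b → Invariant D w →
                  color (e f) ≢ color (e b) → w (e f) ≡ w (e b) →
                  let D′ = addD H (e b) (addD H (e f) D)
                      fc = incF H d D′ e f b (suc c)
                      bc = decB H d D′ e (proj₁ fc) b (proj₂ fc)
                  in  Iteration D c f b (st D′ w (proj₂ bc)) (proj₁ fc) (proj₁ bc)
    delete-both {D} {w} {c} {f} {b} win inv differ wf≡wb = record
      { extends   = D⊆D′
      ; window    = record
          { f≤b           = B.f≤b′
          ; b<d           = ≤-<-trans B.b′≤b W.b<d
          ; deleted-below = I.deleted-below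
          ; deleted-above = B.deleted-above
          ; ends-live     = λ f′<b′ → I.live (<-≤-trans f′<b′ B.b′≤b) , B.live f′<b′ }
      ; invariant = payment-preserves-invariant payment bad inv
      ; progress  = +-mono-≤ (I.moved front-deleted f<b) B.b′≤b
      ; count-f   = I.count
      ; count-b   = B.count }
      where
        open Conflict (conflict win differ)
        module W = Window win
        D′ = addD H (e b) (addD H (e f) D)

        D⊆D′ : D ⊆ D′
        D⊆D′ De = ⊆-addD (e b) (addD H (e f) D) (⊆-addD (e f) D De)

        front-deleted : D′ (e f) ≡ true
        front-deleted = ⊆-addD (e b) (addD H (e f) D) (addD-self (e f) D)

        module I = IncFPost (incF-post d {D′} {f} {b} {suc c} W.f≤b W.b≤f+d
                                       (deletedBelow-mono {D} D⊆D′ W.deleted-below))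
        f′ = proj₁ (incF H d D′ e f b (suc c))
        c₁ = proj₂ (incF H d D′ e f b (suc c))
        module B = DecBPost (decB-post d {D′} {f′} {b} {c₁} I.f′≤b (≤-trans W.b≤f+d (+-monoˡ-≤ d I.f≤f′))
                                       (deletedAbove-mono {D} D⊆D′ W.deleted-above))

        payment : Payment (e f) (e b) (w (e f)) D w D′ w
        payment = record
          { distinct  = front≢back
          ; a-live    = front-live
          ; b-live    = back-live
          ; δ-nonneg  = live-weight-nonneg inv front-live
          ; δ≤w-a     = ℚP.≤-refl
          ; δ≤w-b     = ℚP.≤-reflexive wf≡wb
          ; at-a      = trans (residual-deleted D′ w front-deleted) (sym (ℚP.+-inverseʳ (w (e f))))
          ; at-b      = trans (residual-deleted D′ w (addD-self (e b) (addD H (e f) D)))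
                              (sym (trans (cong (λ x → w (e b) ℚ.- x) wf≡wb) (ℚP.+-inverseʳ (w (e b)))))
          ; elsewhere = λ ≢front ≢back →
              residual-frame D w D′ w (trans (addD-other (addD H (e f) D) ≢back) (addD-other D ≢front)) refl }

    delete-back : ∀ {D w c f b} → Window D f b → Invariant D w →
                  color (e f) ≢ color (e b) → ¬ w (e f) ℚ.< w (e b) →
                  let D′ = addD H (e b) D
                      bc = decB H d D′ e f b (suc c)
                  in  Iteration D c f b (st D′ (setW H (e f) (w (e f) ℚ.- w (e b)) w) (proj₂ bc)) f (proj₁ bc)
    delete-back {D} {w} {c} {f} {b} win inv differ wf≮wb = record
      { extends   = D⊆D′
      ; window    = record
          { f≤b           = B.f≤b′
          ; b<d           = ≤-<-trans B.b′≤b W.b<d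
          ; deleted-below = deletedBelow-mono {D} D⊆D′ W.deleted-below
          ; deleted-above = B.deleted-above
          ; ends-live     = λ f<b′ → front-live′ , B.live f<b′ }
      ; invariant = payment-preserves-invariant payment bad inv
      ; progress  = subst (_≤ f + b) (ℕP.+-suc f _) (+-monoʳ-≤ f (B.moved (addD-self (e b) D) f<b))
      ; count-f   = refl
      ; count-b   = B.count }
      where
        open Conflict (conflict win differ)
        module W = Window win
        D′ = addD H (e b) D
        w′ = setW H (e f) (w (e f) ℚ.- w (e b)) w

        D⊆D′ : D ⊆ D′
        D⊆D′ = ⊆-addD (e b) D

        module B = DecBPost (decB-post d {D′} {f} {b} {suc c} W.f≤b W.b≤f+d
                                       (deletedAbove-mono {D} D⊆D′ W.deleted-above))

        front-live′ : D′ (e f) ≡ false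
        front-live′ = trans (addD-other D front≢back) front-live

        payment : Payment (e f) (e b) (w (e b)) D w D′ w′
        payment = record
          { distinct  = front≢back
          ; a-live    = front-live
          ; b-live    = back-live
          ; δ-nonneg  = live-weight-nonneg inv back-live
          ; δ≤w-a     = ℚP.≮⇒≥ wf≮wb
          ; δ≤w-b     = ℚP.≤-refl
          ; at-a      = trans (residual-live D′ w′ front-live′) (setW-self (e f) _ w)
          ; at-b      = trans (residual-deleted D′ w′ (addD-self (e b) D)) (sym (ℚP.+-inverseʳ (w (e b))))
          ; elsewhere = λ ≢front ≢back →
              residual-frame D w D′ w′ (addD-other D ≢back) (setW-other _ w ≢front) }

    mainLoop-outcome : ∀ t → LoopCorrect t
    mainLoop-outcome zero {f = f} {b} win fuel _ =
      ⊥-elim (<⇒≱ (subst (b <_) (ℕP.+-identityʳ f) fuel) (Window.f≤b win))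
    mainLoop-outcome (suc t) {D} {w} {c} {f} {b} win fuel inv with color (e f) Fin.≟ color (e b)
    ... | yes same = finished win inv same
    ... | no differ with w (e f) ℚP.<? w (e b) | w (e f) ℚP.≟ w (e b)
    ... | yes wf<wb | _         = iterate (delete-front win inv differ wf<wb) fuel (mainLoop-outcome t)
    ... | no _      | yes wf≡wb = iterate (delete-both win inv differ wf≡wb) fuel (mainLoop-outcome t)
    ... | no wf≮wb  | no _      = iterate (delete-back win inv differ wf≮wb) fuel (mainLoop-outcome t)

  _≤ᶜ_ : Rel (Fin m) 0ℓ
  x ≤ᶜ y = toℕ (color x) ≤ toℕ (color y)

  Consistent : List (Fin m) → (Fin m → Bool) → Set
  Consistent L D = ∀ {x y} → x ∈ L → y ∈ L → D x ≡ false → D y ≡ false → color x ≡ color y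

  consistent-mono : ∀ {L D D′} → D ⊆ D′ → Consistent L D → Consistent L D′
  consistent-mono {D = D} {D′} D⊆D′ consistent {x} {y} x∈ y∈ D′x D′y =
    consistent x∈ y∈ (⊆-live {D} {D′} D⊆D′ D′x) (⊆-live {D} {D′} D⊆D′ D′y)

  record Run (P : (Fin m → Bool) → Set) (budget : ℕ) (s s′ : St H) : Set where
    field
      extends     : St.inD s ⊆ St.inD s′
      invariant   : Invariant (St.inD s′) (St.wt s′)
      establishes : P (St.inD s′)
      steps-bound : St.steps s′ ≤ St.steps s + budget

  processNode-run : ∀ {v} L → (∀ {x} → x ∈ L → v ∈ edge x) → Linked _≤ᶜ_ L →
                    ∀ {s} → Invariant (St.inD s) (St.wt s) →
                    Run (Consistent L) (2 * length L) s (processNode H L s)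
  processNode-run [] _ _ inv = record
    { extends = id ; invariant = inv ; establishes = λ () ; steps-bound = ℕP.m≤m+n _ 0 }
  processNode-run {v} L@(x ∷ xs) incident sorted {st D w c} inv = record
    { extends     = O.extends
    ; invariant   = O.invariant
    ; establishes = consistent
    ; steps-bound = potential-initial O.steps-bound I.count B.count B.b′≤b }
    where
      d = length L
      e = at H x L
      open MainLoop v d e (incident ∘ at-∈ L)
                          (at-monotone ℕP.≤-refl (Linked⇒AllPairs ℕP.≤-trans sorted))
      open Pointers d e

      module B = DecBPost (decB-post d {D} {0} {length xs} {c} z≤n (n≤1+n _)
                                     λ xs<i i<d → contradiction (ℕP.≤-pred i<d) (<⇒≱ xs<i))
      b₀ = proj₁ (decB H d D e 0 (length xs) c)
      c₁ = proj₂ (decB H d D e 0 (length xs) c)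
      module I = IncFPost (incF-post d {D} {0} {b₀} {c₁} z≤n (≤-trans B.b′≤b (n≤1+n _)) λ ())
      f₀ = proj₁ (incF H d D e 0 b₀ c₁)

      window : Window D f₀ b₀
      window = record
        { f≤b           = I.f′≤b
        ; b<d           = s≤s B.b′≤b
        ; deleted-below = I.deleted-below
        ; deleted-above = B.deleted-above
        ; ends-live     = λ f₀<b₀ → I.live f₀<b₀ , B.live (≤-<-trans z≤n f₀<b₀) }

      fuel : suc b₀ ≤ f₀ + suc d
      fuel = ≤-trans (s≤s B.b′≤b) (≤-trans (n≤1+n d) (m≤n+m (suc d) f₀))

      module O = Outcome (mainLoop-outcome (suc d) window fuel inv)

      consistent : Consistent L (St.inD (processNode H L (st D w c)))
      consistent y∈ z∈ Dy Dz with ∈⇒at x y∈ | ∈⇒at x z∈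
      ... | i , i<d , refl | j , j<d , refl = O.monochromatic i<d j<d Dy Dz

  run-nodes : ValidIncidence H → ∀ vs {s} → Invariant (St.inD s) (St.wt s) →
              Run (λ D → ∀ {v} → v ∈ vs → Consistent (inc v) D) (2 * foldr (λ v k → deg H v + k) 0 vs)
                  s (foldl (λ s v → processNode H (inc v) s) s vs)
  run-nodes valid [] inv = record
    { extends = id ; invariant = inv ; establishes = λ () ; steps-bound = ℕP.m≤m+n _ 0 }
  run-nodes valid (v ∷ vs) {s} inv = record
    { extends     = R.extends ∘ N.extends
    ; invariant   = R.invariant
    ; establishes = λ { (here refl)  → consistent-mono R.extends N.establishes
                      ; (there v∈vs) → R.establishes v∈vs }
    ; steps-bound = begin
        St.steps s₂                           ≤⟨ R.steps-bound ⟩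
        St.steps s₁ + 2 * rest                ≤⟨ +-monoˡ-≤ (2 * rest) N.steps-bound ⟩
        St.steps s + 2 * deg H v + 2 * rest   ≡⟨ ℕP.+-assoc (St.steps s) _ _ ⟩
        St.steps s + (2 * deg H v + 2 * rest) ≡⟨ cong (St.steps s +_) (ℕP.*-distribˡ-+ 2 (deg H v) rest) ⟨
        St.steps s + 2 * (deg H v + rest)     ∎ }
    where
      open ℕP.≤-Reasoning
      rest = foldr (λ v k → deg H v + k) 0 vs
      s₁ = processNode H (inc v) s
      s₂ = foldl (λ s v → processNode H (inc v) s) s₁ vs
      module N = Run (processNode-run (inc v) (Equivalence.to (proj₁ (valid v) _))
                                      (proj₂ (proj₂ (valid v))) inv)
      module R = Run (run-nodes valid vs N.invariant)

  no-bad-pair : ValidIncidence H → ∀ {D} → (∀ {v} → v ∈ allFin n → Consistent (inc v) D) →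
                ∀ {a b} → D a ≡ false → D b ≡ false → ¬ BadPair H a b
  no-bad-pair valid consistent Da Db ((v , v∈a , v∈b) , colors-differ) =
    colors-differ (consistent (∈-allFin v) (incident v∈a) (incident v∈b) Da Db)
    where
      incident : ∀ {x} → v ∈ edge x → x ∈ inc v
      incident = Equivalence.from (proj₁ (valid v) _)

theorem1 : Σ ℕ (λ c → (H : ECHypergraph) → NonNegWeights H → ValidIncidence H →
      ((e f : Fin (ECHypergraph.m H)) → outD H e ≡ false → outD H f ≡ false → ¬ BadPair H e f)
    × ((col : Fin (ECHypergraph.n H) → Fin (ECHypergraph.k H)) → wOf H (outD H) ℚ.≤ (1ℚ ℚ.+ 1ℚ) ℚ.* cost H col)
    × (outSteps H ℕ.≤ c ℕ.* sumDeg H))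
theorem1 = 2 , λ H nonneg valid →
  let open Execution H
      open LocalRatio H using (initial-invariant; invariant⇒wOf≤2*cost)
      module R = Run (run-nodes valid (allFin _) (initial-invariant nonneg))
  in  (λ _ _ → no-bad-pair valid R.establishes)
    , invariant⇒wOf≤2*cost R.invariant
    , R.steps-bound
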